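{- Let $s \geq 1$ and $t \geq 2$ be integers and let $\alpha_{s,t}$ be the type-$\alpha$ comb with $s$ teeth of length $t$. Then the number of linear extensions of $\alpha_{s,t}$ that avoid both patterns $213$ and $231$ equals $2^{s-1}$.
   Context: A linear extension of a finite poset $P$ on a set of integers is a listing $v=[v_1,\dots,v_n]$ of all elements of $P$, each exactly once, such that whenever $a \leq_P b$, $a$ appears before $b$. For $w \in S_3$, a sequence $v$ of distinct integers contains $w$ if there are indices $i<j<k$ with $(v_i,v_j,v_k)$ in the same relative order as $(w_1,w_2,w_3)$; otherwise $v$ avoids $w$. The type-$\alpha$ comb $\alpha_{s,t}$ is the poset on $\{1,\dots,st\}$ whose order is generated by the relations $i \leq i+1$ for $1 \leq i \leq s-1$ (the spine $1,\dots,s$) and $x \leq x+s$ for $1 \leq x \leq (t-1)s$ (so the teeth are $c, c+s, \dots, c+(t-1)s$ for $1\le c\le s$). -}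

module Defs where

open import Data.Nat using (ℕ; zero; suc; _+_; _*_; _∸_; _≤_; _<_)
open import Data.List using (List; length; upTo; map)
open import Data.List.Relation.Binary.Permutation.Propositional using (_↭_)
open import Data.Fin using (Fin; toℕ)
open import Data.List using (lookup)
open import Data.Product using (Σ; ∃; _×_; _,_)
open import Function.Bundles using (_⇔_)
open import Relation.Binary.Construct.Closure.ReflexiveTransitive using (Star)
open import Relation.Binary.PropositionalEquality using (_≡_)
open import Data.Sum using (_⊎_)

range1 : ℕ → List ℕ
range1 n = map suc (upTo n)

data CombGen (s t : ℕ) : ℕ → ℕ → Set where
  spine : ∀ {i} → 1 ≤ i → i ≤ s ∸ 1 → CombGen s t i (suc i)
  tooth : ∀ {x} → 1 ≤ x → x ≤ (t ∸ 1) * s → CombGen s t x (x + s)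

CombLeq : ℕ → ℕ → ℕ → ℕ → Set
CombLeq s t = Star (CombGen s t)

AppearsBefore : List ℕ → ℕ → ℕ → Set
AppearsBefore v a b =
  Σ (Fin (length v)) λ i → Σ (Fin (length v)) λ j →
    (toℕ i < toℕ j) × (lookup v i ≡ a) × (lookup v j ≡ b)

IsLinearExtension : ℕ → (ℕ → ℕ → Set) → List ℕ → Set
IsLinearExtension n _≤P_ v =
  (v ↭ range1 n) ×
  (∀ a b → a ≤P b → a ≡ b ⊎ AppearsBefore v a b)

Contains3 : (ℕ → ℕ → ℕ → Set) → List ℕ → Set
Contains3 P v =
  Σ (Fin (length v)) λ i → Σ (Fin (length v)) λ j → Σ (Fin (length v)) λ k →
    (toℕ i < toℕ j) × (toℕ j < toℕ k) × P (lookup v i) (lookup v j) (lookup v k)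

Pat213 : ℕ → ℕ → ℕ → Set
Pat213 x y z = (y < x) × (x < z)

Pat231 : ℕ → ℕ → ℕ → Set
Pat231 x y z = (z < x) × (x < y)

Avoids3 : (ℕ → ℕ → ℕ → Set) → List ℕ → Set
Avoids3 P v = Contains3 P v → Data.Empty.⊥
  where import Data.Empty

Good : ℕ → ℕ → List ℕ → Set
Good s t v = IsLinearExtension (s * t) (CombLeq s t) v × Avoids3 Pat213 v × Avoids3 Pat231 v

-- A sequence of distinct numbers avoids 213 and 231 exactly when each entry is
-- the minimum or the maximum of the entries from it onwards. Let K = (t - 1)s,
-- so that K + 1, …, K + s are the tips of the teeth. In a linear extension K
-- precedes K + s, so the maximum K + s cannot be taken while K is still
-- unlisted: the extension starts 1, 2, …, K and continues with an arrangement
-- of the tips in which every entry is the least or the greatest of those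
-- remaining. Conversely every such list is a linear extension, because every
-- strict relation of the comb has its smaller element among 1, …, K. Each of
-- the first s - 1 tips is a free choice between least and greatest, hence the
-- count 2^(s-1).
module Submission where

open import Defs
open import Data.Nat using (ℕ; zero; suc; _+_; _*_; _∸_; _^_; _≤_; _<_; z≤n; s≤s; z<s)
open import Data.Nat.Properties
open import Data.List using (List; []; _∷_; _++_; _∷ʳ_; [_]; length; map; applyUpTo; lookup)
open import Data.List.Properties using (length-map; length-++; ++-cancelˡ; ∷-injectiveˡ; ∷-injectiveʳ)
open import Data.List.Relation.Unary.All as All using (All; []; _∷_)
import Data.List.Relation.Unary.All.Properties as All
open import Data.List.Relation.Unary.Any using (here; there; index)
open import Data.List.Relation.Unary.Any.Properties using (lookup-index)
open import Data.List.Relation.Unary.AllPairs using ([]; _∷_)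
open import Data.List.Relation.Unary.Unique.Propositional using (Unique)
import Data.List.Relation.Unary.Unique.Propositional.Properties as Unique
open import Data.List.Membership.Propositional using (_∈_; _∉_)
open import Data.List.Membership.Propositional.Properties
  using (∈-map⁺; ∈-map⁻; ∈-++⁺ˡ; ∈-++⁺ʳ; ∈-++⁻; ∈-lookup)
open import Data.List.Relation.Binary.Permutation.Propositional
  using (_↭_; ↭-refl; ↭-sym; ↭-trans; ↭-reflexive; prep; ↭⇒↭ₛ)
open import Data.List.Relation.Binary.Permutation.Propositional.Properties
  using (↭-empty-inv; ↭-singleton-inv; drop-∷; ∷↭∷ʳ; ++⁺ˡ; ∈-resp-↭; All-resp-↭)
import Relation.Binary.PropositionalEquality as ≡
open import Data.List.Relation.Binary.Permutation.Setoid.Properties (≡.setoid ℕ) using (Unique-resp-↭)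
open import Data.Fin using () renaming (zero to fzero; suc to fsuc)
open import Data.Product using (Σ; _×_; _,_; proj₁; proj₂)
open import Data.Sum using (_⊎_; inj₁; inj₂)
open import Data.Empty using (⊥-elim)
open import Function using (_∘_; id)
open import Function.Bundles using (_⇔_; mk⇔)
open import Relation.Nullary using (¬_; yes; no)
open import Relation.Binary using (tri<; tri≈; tri>)
open import Relation.Binary.PropositionalEquality
  using (_≡_; refl; sym; trans; cong; cong₂; subst; module ≡-Reasoning)
open import Relation.Binary.Construct.Closure.ReflexiveTransitive using (ε; _◅_)

interval : ℕ → ℕ → List ℕ
interval a zero    = []
interval a (suc m) = suc a ∷ interval (suc a) m

∈-interval⁻ : ∀ {a m y} → y ∈ interval a m → a < y × y ≤ a + m
∈-interval⁻ {a} {suc m} (here refl) = ≤-refl , subst (suc a ≤_) (sym (+-suc a m)) (s≤s (m≤m+n a m))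
∈-interval⁻ {a} {suc m} {y} (there y∈) with ∈-interval⁻ y∈
... | a+1<y , y≤a+1+m = <⇒≤ a+1<y , subst (y ≤_) (sym (+-suc a m)) y≤a+1+m

∈-interval⁺ : ∀ {a m y} → a < y → y ≤ a + m → y ∈ interval a m
∈-interval⁺ {a} {zero}  a<y y≤a+0 = ⊥-elim (<⇒≱ a<y (subst (_ ≤_) (+-identityʳ a) y≤a+0))
∈-interval⁺ {a} {suc m} {y} a<y y≤a+1+m with y ≟ suc a
... | yes refl = here refl
... | no y≢a+1 = there (∈-interval⁺ (≤∧≢⇒< a<y (y≢a+1 ∘ sym)) (subst (y ≤_) (+-suc a m) y≤a+1+m))

interval-unique : ∀ a m → Unique (interval a m)
interval-unique a zero    = []
interval-unique a (suc m) = All.tabulate (<⇒≢ ∘ proj₁ ∘ ∈-interval⁻) ∷ interval-unique (suc a) m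

interval-++ : ∀ a k m → interval a (k + m) ≡ interval a k ++ interval (a + k) m
interval-++ a zero    m = cong (λ b → interval b m) (sym (+-identityʳ a))
interval-++ a (suc k) m = cong (suc a ∷_) (begin
  interval (suc a) (k + m)                     ≡⟨ interval-++ (suc a) k m ⟩
  interval (suc a) k ++ interval (suc a + k) m ≡⟨ cong (λ b → interval (suc a) k ++ interval b m) (sym (+-suc a k)) ⟩
  interval (suc a) k ++ interval (a + suc k) m ∎)
  where open ≡-Reasoning

interval-∷ʳ : ∀ a m → interval a (suc m) ≡ interval a m ∷ʳ (a + suc m)
interval-∷ʳ a zero    = cong [_] (sym (+-comm a 1))
interval-∷ʳ a (suc m) = cong (suc a ∷_) (trans (interval-∷ʳ (suc a) m)
                                               (cong (interval (suc a) m ∷ʳ_) (sym (+-suc a (suc m)))))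

map-suc-applyUpTo : ∀ a n (f : ℕ → ℕ) → (∀ i → f i ≡ a + i) → map suc (applyUpTo f n) ≡ interval a n
map-suc-applyUpTo a zero    f f≗a+ = refl
map-suc-applyUpTo a (suc n) f f≗a+ =
  cong₂ _∷_ (cong suc (trans (f≗a+ 0) (+-identityʳ a)))
            (map-suc-applyUpTo (suc a) n (f ∘ suc) (λ i → trans (f≗a+ (suc i)) (+-suc a i)))

range1≡interval : ∀ n → range1 n ≡ interval 0 n
range1≡interval n = map-suc-applyUpTo 0 n id (λ _ → refl)

MinOrMax : ℕ → List ℕ → Set
MinOrMax x xs = All (x <_) xs ⊎ All (_< x) xs

data SuffixExtremal : List ℕ → Set where
  []  : SuffixExtremal []
  _∷_ : ∀ {x xs} → MinOrMax x xs → SuffixExtremal xs → SuffixExtremal (x ∷ xs)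

Between : ℕ → ℕ → ℕ → Set
Between x y z = Pat213 x y z ⊎ Pat231 x y z

contains3-∷ : ∀ {P x xs} → Contains3 P xs → Contains3 P (x ∷ xs)
contains3-∷ (i , j , k , i<j , j<k , p) = fsuc i , fsuc j , fsuc k , s≤s i<j , s≤s j<k , p

contains3-∷∷ : ∀ {P : ℕ → ℕ → ℕ → Set} {x y z ys} → z ∈ ys → P x y z → Contains3 P (x ∷ y ∷ ys)
contains3-∷∷ {P} {x} {y} z∈ys p =
  fzero , fsuc fzero , fsuc (fsuc (index z∈ys)) , s≤s z≤n , s≤s (s≤s z≤n) ,
  subst (P x y) (lookup-index z∈ys) p

minOrMax-¬between : ∀ {x xs y z} → MinOrMax x xs → y ∈ xs → z ∈ xs → ¬ Between x y z
minOrMax-¬between (inj₁ x<xs) y∈ _  (inj₁ (y<x , _)) = <-asym y<x (All.lookup x<xs y∈)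
minOrMax-¬between (inj₁ x<xs) _  z∈ (inj₂ (z<x , _)) = <-asym z<x (All.lookup x<xs z∈)
minOrMax-¬between (inj₂ xs<x) _  z∈ (inj₁ (_ , x<z)) = <-asym x<z (All.lookup xs<x z∈)
minOrMax-¬between (inj₂ xs<x) y∈ _  (inj₂ (_ , x<y)) = <-asym x<y (All.lookup xs<x y∈)

suffixExtremal⇒avoids : ∀ {P v} → (∀ {x y z} → P x y z → Between x y z) → SuffixExtremal v → Avoids3 P v
suffixExtremal⇒avoids P⊆between (x-ext ∷ _) (fzero , fsuc j , fsuc k , _ , _ , p) =
  minOrMax-¬between x-ext (∈-lookup j) (∈-lookup k) (P⊆between p)
suffixExtremal⇒avoids P⊆between (_ ∷ ext) (fsuc i , fsuc j , fsuc k , s≤s i<j , s≤s j<k , p) =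
  suffixExtremal⇒avoids P⊆between ext (i , j , k , i<j , j<k , p)

avoids⇒minOrMax : ∀ {x xs} → x ∉ xs → Avoids3 Pat213 (x ∷ xs) → Avoids3 Pat231 (x ∷ xs) → MinOrMax x xs
avoids⇒minOrMax {x} {[]}     _   _     _     = inj₁ []
avoids⇒minOrMax {x} {y ∷ ys} x∉ no213 no231 with <-cmp x y
... | tri< x<y _ _ = inj₁ (x<y ∷ All.tabulate above)
  where
  above : ∀ {z} → z ∈ ys → x < z
  above {z} z∈ with <-cmp x z
  ... | tri< x<z _ _  = x<z
  ... | tri≈ _ refl _ = ⊥-elim (x∉ (there z∈))
  ... | tri> _ _ z<x  = ⊥-elim (no231 (contains3-∷∷ {P = Pat231} z∈ (z<x , x<y)))
... | tri≈ _ refl _ = ⊥-elim (x∉ (here refl))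
... | tri> _ _ y<x = inj₂ (y<x ∷ All.tabulate below)
  where
  below : ∀ {z} → z ∈ ys → z < x
  below {z} z∈ with <-cmp x z
  ... | tri< x<z _ _  = ⊥-elim (no213 (contains3-∷∷ {P = Pat213} z∈ (y<x , x<z)))
  ... | tri≈ _ refl _ = ⊥-elim (x∉ (there z∈))
  ... | tri> _ _ z<x  = z<x

avoids⇒suffixExtremal : ∀ {v} → Unique v → Avoids3 Pat213 v → Avoids3 Pat231 v → SuffixExtremal v
avoids⇒suffixExtremal {[]}     _ _     _     = []
avoids⇒suffixExtremal {x ∷ xs} u@(_ ∷ xs-unique) no213 no231 =
  avoids⇒minOrMax (Unique.Unique[x∷xs]⇒x∉xs u) no213 no231 ∷
  avoids⇒suffixExtremal xs-unique (no213 ∘ contains3-∷ {P = Pat213}) (no231 ∘ contains3-∷ {P = Pat231})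

appearsBefore-∷ : ∀ {x xs a b} → AppearsBefore xs a b → AppearsBefore (x ∷ xs) a b
appearsBefore-∷ (i , j , i<j , xsᵢ≡a , xsⱼ≡b) = fsuc i , fsuc j , s≤s i<j , xsᵢ≡a , xsⱼ≡b

appearsBefore-head : ∀ {a b xs} → b ∈ xs → AppearsBefore (a ∷ xs) a b
appearsBefore-head b∈xs = fzero , fsuc (index b∈xs) , s≤s z≤n , refl , sym (lookup-index b∈xs)

lookup-injective : ∀ {xs : List ℕ} → Unique xs → ∀ {i j} → lookup xs i ≡ lookup xs j → i ≡ j
lookup-injective {x ∷ xs} _            {fzero}  {fzero}  _  = refl
lookup-injective {x ∷ xs} (x∉xs ∷ _)   {fzero}  {fsuc j} eq = ⊥-elim (All.lookup x∉xs (∈-lookup j) eq)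
lookup-injective {x ∷ xs} (x∉xs ∷ _)   {fsuc i} {fzero}  eq = ⊥-elim (All.lookup x∉xs (∈-lookup i) (sym eq))
lookup-injective {x ∷ xs} (_ ∷ unique) {fsuc i} {fsuc j} eq = cong fsuc (lookup-injective unique eq)

appearsBefore-asym : ∀ {v a b} → Unique v → AppearsBefore v a b → ¬ AppearsBefore v b a
appearsBefore-asym u (i , j , i<j , vᵢ≡a , vⱼ≡b) (i′ , j′ , i′<j′ , vᵢ′≡b , vⱼ′≡a)
  with refl ← lookup-injective u (trans vᵢ≡a (sym vⱼ′≡a))
     | refl ← lookup-injective u (trans vⱼ≡b (sym vᵢ′≡b)) = <-asym i<j i′<j′

appearsBefore-interval-++ : ∀ k c {a b} w → c < a → a ≤ c + k → a < b → b ∈ interval c k ++ w →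
  AppearsBefore (interval c k ++ w) a b
appearsBefore-interval-++ zero    c w c<a a≤c+0 _ _ = ⊥-elim (<⇒≱ c<a (subst (_ ≤_) (+-identityʳ c) a≤c+0))
appearsBefore-interval-++ (suc k) c w c<a _ a<b (here refl) = ⊥-elim (<⇒≱ c<a (≤-pred a<b))
appearsBefore-interval-++ (suc k) c {a} w c<a a≤c+1+k a<b (there b∈) with a ≟ suc c
... | yes refl = appearsBefore-head b∈
... | no a≢c+1 = appearsBefore-∷ (appearsBefore-interval-++ k (suc c) w (≤∧≢⇒< c<a (a≢c+1 ∘ sym))
                                    (subst (a ≤_) (+-suc c k) a≤c+1+k) a<b b∈)

-- With a single element left, least and greatest coincide: hence the separate
-- clause, which keeps the two branches disjoint.
extremalArrangements : ℕ → ℕ → List (List ℕ)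
extremalArrangements a zero          = [ [] ]
extremalArrangements a (suc zero)    = [ [ suc a ] ]
extremalArrangements a (suc (suc m)) =
  map (suc a ∷_) (extremalArrangements (suc a) (suc m)) ++
  map (a + suc (suc m) ∷_) (extremalArrangements a (suc m))

length-extremalArrangements : ∀ a m → length (extremalArrangements a m) ≡ 2 ^ (m ∸ 1)
length-extremalArrangements a zero          = refl
length-extremalArrangements a (suc zero)    = refl
length-extremalArrangements a (suc (suc m)) = begin
  length (map (suc a ∷_) lower ++ map (a + suc (suc m) ∷_) upper)
    ≡⟨ length-++ (map (suc a ∷_) lower) ⟩
  length (map (suc a ∷_) lower) + length (map (a + suc (suc m) ∷_) upper)
    ≡⟨ cong₂ _+_ (length-map _ lower) (length-map _ upper) ⟩
  length lower + length upper
    ≡⟨ cong₂ _+_ (length-extremalArrangements (suc a) (suc m)) (length-extremalArrangements a (suc m)) ⟩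
  2 ^ m + 2 ^ m
    ≡⟨ cong (2 ^ m +_) (sym (+-identityʳ (2 ^ m))) ⟩
  2 ^ suc m ∎
  where
  open ≡-Reasoning
  lower upper : List (List ℕ)
  lower = extremalArrangements (suc a) (suc m)
  upper = extremalArrangements a (suc m)

extremalArrangements-unique : ∀ a m → Unique (extremalArrangements a m)
extremalArrangements-unique a zero          = [] ∷ []
extremalArrangements-unique a (suc zero)    = [] ∷ []
extremalArrangements-unique a (suc (suc m)) =
  Unique.++⁺ (Unique.map⁺ ∷-injectiveʳ (extremalArrangements-unique (suc a) (suc m)))
             (Unique.map⁺ ∷-injectiveʳ (extremalArrangements-unique a (suc m)))
             disjoint
  where
  a+1<a+2+m : suc a < a + suc (suc m)
  a+1<a+2+m = subst (_< a + suc (suc m)) (+-comm a 1) (+-monoʳ-< a (s≤s (s≤s z≤n)))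
  disjoint : ∀ {v} → ¬ (v ∈ map (suc a ∷_) (extremalArrangements (suc a) (suc m)) ×
                        v ∈ map (a + suc (suc m) ∷_) (extremalArrangements a (suc m)))
  disjoint (v∈lower , v∈upper) with ∈-map⁻ _ v∈lower | ∈-map⁻ _ v∈upper
  ... | _ , _ , refl | _ , _ , heads≡ = <⇒≢ a+1<a+2+m (∷-injectiveˡ heads≡)

uncons-interval : ∀ {a m x xs} → x ∷ xs ↭ interval a (suc m) → MinOrMax x xs →
  (x ≡ suc a × xs ↭ interval (suc a) m) ⊎ (x ≡ a + suc m × xs ↭ interval a m)
uncons-interval {a} {m} x∷xs↭ (inj₁ x<xs) with ∈-resp-↭ (↭-sym x∷xs↭) (here refl)
... | here refl   = inj₁ (refl , drop-∷ x∷xs↭)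
... | there a+1∈xs =
  ⊥-elim (<⇒≱ (All.lookup x<xs a+1∈xs) (proj₁ (∈-interval⁻ (∈-resp-↭ x∷xs↭ (here refl)))))
uncons-interval {a} {m} x∷xs↭ (inj₂ xs<x) with ∈-resp-↭ (↭-sym x∷xs↭) (∈-interval⁺ (m<m+n a z<s) ≤-refl)
... | here refl =
  inj₂ (refl , drop-∷ (↭-trans x∷xs↭ (↭-trans (↭-reflexive (interval-∷ʳ a m)) (↭-sym (∷↭∷ʳ _ _)))))
... | there top∈xs =
  ⊥-elim (<⇒≱ (All.lookup xs<x top∈xs) (proj₂ (∈-interval⁻ (∈-resp-↭ x∷xs↭ (here refl)))))

∈-extremalArrangements⁻ : ∀ a m {w} → w ∈ extremalArrangements a m → w ↭ interval a m × SuffixExtremal w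
∈-extremalArrangements⁻ a zero          (here refl) = ↭-refl , []
∈-extremalArrangements⁻ a (suc zero)    (here refl) = ↭-refl , inj₁ [] ∷ []
∈-extremalArrangements⁻ a (suc (suc m)) w∈ with ∈-++⁻ (map (suc a ∷_) (extremalArrangements (suc a) (suc m))) w∈
... | inj₁ w∈lower with ∈-map⁻ _ w∈lower
...   | w′ , w′∈ , refl with ∈-extremalArrangements⁻ (suc a) (suc m) w′∈
...     | w′↭ , w′-ext =
  prep (suc a) w′↭ , inj₁ (All-resp-↭ (↭-sym w′↭) (All.tabulate (proj₁ ∘ ∈-interval⁻))) ∷ w′-ext
∈-extremalArrangements⁻ a (suc (suc m)) w∈ | inj₂ w∈upper with ∈-map⁻ _ w∈upper
...   | w′ , w′∈ , refl with ∈-extremalArrangements⁻ a (suc m) w′∈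
...     | w′↭ , w′-ext =
  ↭-trans (prep _ w′↭) (↭-trans (∷↭∷ʳ _ _) (↭-reflexive (sym (interval-∷ʳ a (suc m))))) ,
  inj₂ (All-resp-↭ (↭-sym w′↭) (All.tabulate (below-top ∘ proj₂ ∘ ∈-interval⁻))) ∷ w′-ext
  where
  below-top : ∀ {y} → y ≤ a + suc m → y < a + suc (suc m)
  below-top {y} y≤ = subst (y <_) (sym (+-suc a (suc m))) (s≤s y≤)

∈-extremalArrangements⁺ : ∀ a m {w} → w ↭ interval a m → SuffixExtremal w → w ∈ extremalArrangements a m
∈-extremalArrangements⁺ a zero w↭ _ with refl ← ↭-empty-inv w↭ = here refl
∈-extremalArrangements⁺ a (suc zero) w↭ _ with refl ← ↭-singleton-inv w↭ = here refl
∈-extremalArrangements⁺ a (suc (suc m)) {[]} w↭ _ with () ← ↭-empty-inv (↭-sym w↭)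
∈-extremalArrangements⁺ a (suc (suc m)) {x ∷ xs} w↭ (x-ext ∷ xs-ext) with uncons-interval w↭ x-ext
... | inj₁ (refl , xs↭) = ∈-++⁺ˡ (∈-map⁺ (suc a ∷_) (∈-extremalArrangements⁺ (suc a) (suc m) xs↭ xs-ext))
... | inj₂ (refl , xs↭) = ∈-++⁺ʳ _ (∈-map⁺ (a + suc (suc m) ∷_) (∈-extremalArrangements⁺ a (suc m) xs↭ xs-ext))

suffixExtremal-interval-++ : ∀ c k {w} → All (c + k <_) w → SuffixExtremal w → SuffixExtremal (interval c k ++ w)
suffixExtremal-interval-++ c zero    _       w-ext = w-ext
suffixExtremal-interval-++ c (suc k) w-above w-ext =
  inj₁ (All.++⁺ (All.tabulate (proj₁ ∘ ∈-interval⁻)) (All.map (≤-<-trans c+1≤c+1+k) w-above)) ∷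
  suffixExtremal-interval-++ (suc c) k (All.map (λ {y} → subst (_< y) (+-suc c k)) w-above) w-ext
  where
  c+1≤c+1+k : suc c ≤ c + suc k
  c+1≤c+1+k = proj₂ (∈-interval⁻ {c} {suc k} (here refl))

-- A maximum among the first d entries would be K + suc m, with K still to come.
suffixExtremal-interval-prefix : ∀ {K m} d c {v} → c + d ≡ K → v ↭ interval c (d + suc m) →
  SuffixExtremal v → ¬ AppearsBefore v (K + suc m) K →
  Σ (List ℕ) λ w → v ≡ interval c d ++ w × w ↭ interval K (suc m) × SuffixExtremal w
suffixExtremal-interval-prefix {m = m} zero c {v} c+0≡K v↭ v-ext _ =
  v , refl , subst (λ b → v ↭ interval b (suc m)) (trans (sym (+-identityʳ c)) c+0≡K) v↭ , v-ext
suffixExtremal-interval-prefix (suc d) c {[]} _ v↭ _ _ with () ← ↭-empty-inv (↭-sym v↭)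
suffixExtremal-interval-prefix {K} {m} (suc d) c {x ∷ xs} c+1+d≡K v↭ (x-ext ∷ xs-ext) max≮K
  with uncons-interval v↭ x-ext
... | inj₁ (refl , xs↭)
  with suffixExtremal-interval-prefix d (suc c) (trans (sym (+-suc c d)) c+1+d≡K) xs↭ xs-ext
         (max≮K ∘ appearsBefore-∷)
...   | w , refl , w↭ , w-ext = w , refl , w↭ , w-ext
suffixExtremal-interval-prefix {K} {m} (suc d) c {x ∷ xs} c+1+d≡K v↭ (x-ext ∷ xs-ext) max≮K
  | inj₂ (x≡top , _) = ⊥-elim (max≮K (subst (λ y → AppearsBefore (x ∷ xs) y K) x≡max (appearsBefore-head K∈xs)))
  where
  x≡max : x ≡ K + suc m
  x≡max = trans x≡top (trans (sym (+-assoc c (suc d) (suc m))) (cong (_+ suc m) c+1+d≡K))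
  K∈xs : K ∈ xs
  K∈v : K ∈ x ∷ xs
  K∈v = ∈-resp-↭ (↭-sym v↭) (∈-interval⁺ (subst (c <_) c+1+d≡K (m<m+n c z<s))
          (subst (_≤ c + suc (d + suc m)) c+1+d≡K (+-monoʳ-≤ c (m≤m+n (suc d) (suc m)))))
  K∈xs with K∈v
  ... | here K≡x  = ⊥-elim (<⇒≢ (m<m+n K z<s) (trans K≡x x≡max))
  ... | there K∈xs = K∈xs

module Comb (s′ t′ : ℕ) where

  s t K : ℕ
  s = suc s′
  t = suc (suc t′)
  K = (t ∸ 1) * s

  s*t≡K+s : s * t ≡ K + s
  s*t≡K+s = begin
    s * suc (suc t′)   ≡⟨ *-suc s (suc t′) ⟩
    s + s * suc t′     ≡⟨ +-comm s (s * suc t′) ⟩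
    s * suc t′ + s     ≡⟨ cong (_+ s) (*-comm s (suc t′)) ⟩
    K + s              ∎
    where open ≡-Reasoning

  s≤K : s ≤ K
  s≤K = m≤m+n s (t′ * s)

  _≺_ : ℕ → ℕ → Set
  a ≺ b = 1 ≤ a × a ≤ K × a < b × b ≤ K + s

  combGen⇒≺ : ∀ {a b} → CombGen s t a b → a ≺ b
  combGen⇒≺ (spine {i} 1≤i i≤s′) =
    1≤i , ≤-trans i≤s′ (≤-trans (n≤1+n s′) s≤K) , n<1+n i , ≤-trans (s≤s i≤s′) (m≤n+m s K)
  combGen⇒≺ (tooth {x} 1≤x x≤K) = 1≤x , x≤K , m<m+n x z<s , +-monoˡ-≤ s x≤K

  combLeq⇒≡⊎≺ : ∀ {a b} → CombLeq s t a b → a ≡ b ⊎ a ≺ b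
  combLeq⇒≡⊎≺ ε = inj₁ refl
  combLeq⇒≡⊎≺ (g ◅ g*) with combGen⇒≺ g | combLeq⇒≡⊎≺ g*
  ... | a≺b                   | inj₁ refl                 = inj₂ a≺b
  ... | (1≤a , a≤K , a<b , _) | inj₂ (_ , _ , b<c , c≤top) = inj₂ (1≤a , a≤K , <-trans a<b b<c , c≤top)

  goodExtensions : List (List ℕ)
  goodExtensions = map (interval 0 K ++_) (extremalArrangements K s)

  range1≡interval-K+s : range1 (s * t) ≡ interval 0 (K + s)
  range1≡interval-K+s = trans (range1≡interval (s * t)) (cong (interval 0) s*t≡K+s)

  ∈⇒good : ∀ v → v ∈ goodExtensions → Good s t v
  ∈⇒good v v∈ with ∈-map⁻ (interval 0 K ++_) v∈
  ... | w , w∈ , refl = (↭-trans v↭ (↭-reflexive (sym range1≡interval-K+s)) , ordered) ,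
                        suffixExtremal⇒avoids inj₁ v-ext ,
                        suffixExtremal⇒avoids inj₂ v-ext
    where
    w↭ : w ↭ interval K s
    w↭ = proj₁ (∈-extremalArrangements⁻ K s w∈)
    v↭ : v ↭ interval 0 (K + s)
    v↭ = ↭-trans (++⁺ˡ (interval 0 K) w↭) (↭-reflexive (sym (interval-++ 0 K s)))
    v-ext : SuffixExtremal v
    v-ext = suffixExtremal-interval-++ 0 K (All-resp-↭ (↭-sym w↭) (All.tabulate (proj₁ ∘ ∈-interval⁻)))
                                           (proj₂ (∈-extremalArrangements⁻ K s w∈))
    ordered : ∀ a b → CombLeq s t a b → a ≡ b ⊎ AppearsBefore v a b
    ordered a b a≤b with combLeq⇒≡⊎≺ a≤b
    ... | inj₁ a≡b = inj₁ a≡b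
    ... | inj₂ (1≤a , a≤K , a<b , b≤K+s) =
      inj₂ (appearsBefore-interval-++ K 0 w 1≤a a≤K a<b
              (∈-resp-↭ (↭-sym v↭) (∈-interval⁺ (≤-trans 1≤a (<⇒≤ a<b)) b≤K+s)))

  good⇒∈ : ∀ v → Good s t v → v ∈ goodExtensions
  good⇒∈ v ((v↭range , ordered) , no213 , no231)
    with suffixExtremal-interval-prefix K 0 refl v↭ (avoids⇒suffixExtremal v-unique no213 no231) max≮K
    where
    v↭ : v ↭ interval 0 (K + s)
    v↭ = ↭-trans v↭range (↭-reflexive range1≡interval-K+s)
    v-unique : Unique v
    v-unique = Unique-resp-↭ (↭⇒↭ₛ (↭-sym v↭)) (interval-unique 0 (K + s))
    max≮K : ¬ AppearsBefore v (K + s) K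
    max≮K with ordered K (K + s) (tooth (≤-trans (s≤s z≤n) s≤K) ≤-refl ◅ ε)
    ... | inj₁ K≡K+s  = ⊥-elim (<⇒≢ (m<m+n K z<s) K≡K+s)
    ... | inj₂ K≺max = appearsBefore-asym v-unique K≺max
  ... | w , refl , w↭ , w-ext = ∈-map⁺ (interval 0 K ++_) (∈-extremalArrangements⁺ K s w↭ w-ext)

theorem11 : (s t : ℕ) → 1 ≤ s → 2 ≤ t →
    Σ (List (List ℕ)) λ L →
      Unique L × (∀ v → (v ∈ L) ⇔ Good s t v) × (length L ≡ 2 ^ (s ∸ 1))
theorem11 (suc s′) (suc (suc t′)) _ _ =
  goodExtensions ,
  Unique.map⁺ (++-cancelˡ (interval 0 K) _ _) (extremalArrangements-unique K s) ,
  (λ v → mk⇔ (∈⇒good v) (good⇒∈ v)) ,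
  trans (length-map _ (extremalArrangements K s)) (length-extremalArrangements K s)
  where open Comb s′ t′
theorem11 (suc s′) (suc zero) _ (s≤s ())
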